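{- For any integer $r\geq 3$ and any $n$, $\operatorname{sat}(n,\mathfrak{R}(K_r))\leq 2(r-2)n$.
   Context: An edge-coloured graph here is a graph with a (not necessarily proper) colouring of its edges by colours from the infinite palette of natural numbers. A copy of $H$ is rainbow if all its edges receive distinct colours; $\mathfrak{R}(H)$ denotes the family of rainbow copies of $H$. An edge-coloured graph is $\mathfrak{R}(H)$-saturated if it contains no rainbow copy of $H$ but adding any non-edge in any colour creates a rainbow copy of $H$. $\operatorname{sat}(n,\mathfrak{R}(H))$ is the minimum number of edges of such a graph on $n$ vertices. -}

module Defs where

open import Data.Nat using (ℕ; zero; suc; _+_; _*_; _∸_; _≤_)
open import Data.Fin using (Fin; toℕ; _≟_)
open import Data.Maybe using (Maybe; just; nothing; is-just)
open import Data.List using (List; map; allFin)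
open import Data.Nat.ListAction using (sum)
open import Data.Bool using (Bool; true; false; if_then_else_; _∧_)
open import Data.Product using (Σ; _×_; _,_)
open import Data.Sum using (_⊎_)
open import Relation.Nullary using (¬_; Dec; yes; no)
open import Relation.Nullary.Decidable using (⌊_⌋)
open import Relation.Binary.PropositionalEquality using (_≡_; _≢_)
import Data.Nat as ℕ

-- An edge-coloured (simple, loopless) graph on vertex set Fin n.
-- col i j = nothing  : ij is not an edge;
-- col i j = just k   : ij is an edge of colour k ∈ ℕ (colours need not be proper).
record ECGraph (n : ℕ) : Set where
  field
    col    : Fin n → Fin n → Maybe ℕ
    symm   : ∀ i j → col i j ≡ col j i
    irrefl : ∀ i → col i i ≡ nothing
open ECGraph public

SamePair : ∀ {m} → Fin m → Fin m → Fin m → Fin m → Set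
SamePair a b a' b' = (a ≡ a' × b ≡ b') ⊎ (a ≡ b' × b ≡ a')

IsRainbowK : ∀ {n} (r : ℕ) → (Fin n → Fin n → Maybe ℕ) → (Fin r → Fin n) → Set
IsRainbowK {n} r c f =
  (∀ a b → f a ≡ f b → a ≡ b) ×
  (∀ a b → a ≢ b → Σ ℕ λ k → c (f a) (f b) ≡ just k) ×
  (∀ a b a' b' k → a ≢ b → a' ≢ b' →
     c (f a) (f b) ≡ just k → c (f a') (f b') ≡ just k → SamePair a b a' b')

HasRainbowK : ∀ {n} (r : ℕ) → (Fin n → Fin n → Maybe ℕ) → Set
HasRainbowK {n} r c = Σ (Fin r → Fin n) λ f → IsRainbowK r c f

addEdge : ∀ {n} → (Fin n → Fin n → Maybe ℕ) → Fin n → Fin n → ℕ → Fin n → Fin n → Maybe ℕ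
addEdge c u v k x y =
  if (⌊ x ≟ u ⌋ ∧ ⌊ y ≟ v ⌋) Data.Bool.∨ (⌊ x ≟ v ⌋ ∧ ⌊ y ≟ u ⌋)
  then just k else c x y

RainbowSaturated : ∀ {n} (r : ℕ) → ECGraph n → Set
RainbowSaturated r G =
  ¬ HasRainbowK r (col G) ×
  (∀ u v → u ≢ v → col G u v ≡ nothing → ∀ (k : ℕ) → HasRainbowK r (addEdge (col G) u v k))

edgeCount : ∀ {n} → ECGraph n → ℕ
edgeCount {n} G =
  sum (map (λ i → sum (map (λ j →
    if (toℕ i ℕ.<ᵇ toℕ j) ∧ is-just (col G i j) then 1 else 0) (allFin n))) (allFin n))

-- Let m = r - 2 and split the vertices 0 … n-1 into A = [0,m), B = [m,2m) and the rest R.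
-- A and B are cliques, A ∪ B is completely joined to R, R is independent, and all edges
-- between A and B get colour 0 (for r = 3 these pairs are non-edges instead). Every other edge
-- {a,b} is coloured by the pair code min a b + max a b · n, so these colours are all distinct.
-- Every edge meets A ∪ B, which bounds the number of edges by 2mn.
--   * No rainbow K_r: for r ≥ 4, pigeonhole on the positions of vertices inside their classes
--     puts an A–B edge into any K_{m+2}; all further clique vertices must then lie in the
--     independent set R, and there are at least two of them. For r = 3 the graph is bipartite.
--   * Saturation: a missing edge uv lies inside R (or is the pair {0,1} when r = 3). Its colour
--     k is the code of at most one pair, whose minimum is k mod n; the block A or B avoiding it
--     forms with u, v a K_r minus uv whose colours are codes different from k, and adding uv
--     completes a rainbow K_r. For the pair {0,1} a vertex of R plays the same role, and for
--     r = 3, n ≤ 3 the monochromatic complete graph is used.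
-- The file first develops general facts (an edge-counting bound, the effect of adding an edge,
-- a rainbow criterion and the completion lemma, pair codes), then the construction with its
-- edge bound and saturation inside R, then the cases r = 3 and r ≥ 4, and finally the theorem.
module Submission where

open import Defs
open import Data.Nat using (ℕ; zero; suc; _+_; _*_; _∸_; _≤_; _<_; _⊔_; _⊓_; z≤n; s≤s; _<ᵇ_; NonZero)
import Data.Nat as ℕ
open import Data.Nat.Properties
open import Data.Nat.ListAction using (sum)
open import Data.Fin as Fin using (Fin; zero; suc; toℕ; fromℕ<; punchIn; punchOut)
import Data.Fin.Properties as Finₚ
open Finₚ using (toℕ-injective)
open import Data.Maybe using (Maybe; just; nothing; is-just)
open import Data.Maybe.Properties using (just-injective)
open import Data.Bool using (true; false; T; if_then_else_; _∧_)
open import Data.List using (map; allFin)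
open import Data.List.Properties using (map-tabulate)
open import Data.Product using (Σ; _×_; _,_; proj₁; proj₂)
open import Data.Sum using (_⊎_; inj₁; inj₂)
open import Data.Empty using (⊥; ⊥-elim)
open import Data.Unit using (tt)
open import Relation.Nullary using (¬_; yes; no; contradiction)
open import Relation.Binary.PropositionalEquality
open import Function using (_∘_; id)
import Data.Nat.DivMod as DM

sum-allFin-suc : ∀ N (h : Fin (suc N) → ℕ) →
                 sum (map h (allFin (suc N))) ≡ h zero + sum (map (h ∘ suc) (allFin N))
sum-allFin-suc N h = cong (λ l → h zero + sum l)
  (trans (map-tabulate suc h) (sym (map-tabulate id (h ∘ suc))))

sum-≤ : ∀ N K B (h : Fin N → ℕ) → (∀ i → h i ≤ B) → (∀ i → K ≤ toℕ i → h i ≡ 0) →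
        sum (map h (allFin N)) ≤ K * B
sum-≤ zero    K       B h h≤B h≡0 = z≤n
sum-≤ (suc N) zero    B h h≤B h≡0 rewrite sum-allFin-suc N h | h≡0 zero z≤n =
  sum-≤ N zero B (h ∘ suc) (h≤B ∘ suc) (λ i _ → h≡0 (suc i) z≤n)
sum-≤ (suc N) (suc K) B h h≤B h≡0 rewrite sum-allFin-suc N h = +-mono-≤ (h≤B zero)
  (sum-≤ N K B (h ∘ suc) (h≤B ∘ suc) (λ i K≤i → h≡0 (suc i) (s≤s K≤i)))

edgeCount-≤ : ∀ {n} (G : ECGraph n) (K : ℕ) →
              (∀ i j → K ≤ toℕ i → toℕ i < toℕ j → col G i j ≡ nothing) → edgeCount G ≤ K * n
edgeCount-≤ {n} G K high-free = sum-≤ n K n row row-≤ row-high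
  where
    term : Fin n → Fin n → ℕ
    term i j = if (toℕ i <ᵇ toℕ j) ∧ is-just (col G i j) then 1 else 0
    row : Fin n → ℕ
    row i = sum (map (term i) (allFin n))
    indicator-≤1 : ∀ b → (if b then 1 else 0) ≤ 1
    indicator-≤1 true  = s≤s z≤n
    indicator-≤1 false = z≤n
    term-high : ∀ i j → K ≤ toℕ i → term i j ≡ 0
    term-high i j K≤i with toℕ i <ᵇ toℕ j in i<ᵇj
    ... | false = refl
    ... | true rewrite high-free i j K≤i (<ᵇ⇒< (toℕ i) (toℕ j) (subst T (sym i<ᵇj) tt)) = refl
    row-≤ : ∀ i → row i ≤ n
    row-≤ i = subst (row i ≤_) (*-identityʳ n)
      (sum-≤ n n 1 (term i) (λ j → indicator-≤1 _) (λ j n≤j → contradiction (Finₚ.toℕ<n j) (≤⇒≯ n≤j)))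
    row-high : ∀ i → K ≤ toℕ i → row i ≡ 0
    row-high i K≤i = n≤0⇒n≡0 (sum-≤ n 0 1 (term i) (λ j → indicator-≤1 _) (λ j _ → term-high i j K≤i))

SamePair-sym : ∀ {m} {a b a' b' : Fin m} → SamePair a b a' b' → SamePair a' b' a b
SamePair-sym (inj₁ (e₁ , e₂)) = inj₁ (sym e₁ , sym e₂)
SamePair-sym (inj₂ (e₁ , e₂)) = inj₂ (sym e₂ , sym e₁)

SamePair-trans : ∀ {m} {a b a' b' a'' b'' : Fin m} →
                 SamePair a b a' b' → SamePair a' b' a'' b'' → SamePair a b a'' b''
SamePair-trans (inj₁ (refl , refl)) q = q
SamePair-trans (inj₂ (refl , refl)) (inj₁ (refl , refl)) = inj₂ (refl , refl)
SamePair-trans (inj₂ (refl , refl)) (inj₂ (refl , refl)) = inj₁ (refl , refl)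

SamePair-map : ∀ {r n} (g : Fin r → Fin n) {a b a' b'} →
               SamePair a b a' b' → SamePair (g a) (g b) (g a') (g b')
SamePair-map g (inj₁ (e₁ , e₂)) = inj₁ (cong g e₁ , cong g e₂)
SamePair-map g (inj₂ (e₁ , e₂)) = inj₂ (cong g e₁ , cong g e₂)

SamePair-reflect : ∀ {r n} (g : Fin r → Fin n) → (∀ a b → g a ≡ g b → a ≡ b) →
                   ∀ {a b a' b'} → SamePair (g a) (g b) (g a') (g b') → SamePair a b a' b'
SamePair-reflect g g-inj (inj₁ (e₁ , e₂)) = inj₁ (g-inj _ _ e₁ , g-inj _ _ e₂)
SamePair-reflect g g-inj (inj₂ (e₁ , e₂)) = inj₂ (g-inj _ _ e₁ , g-inj _ _ e₂)

module _ {n : ℕ} (c : Fin n → Fin n → Maybe ℕ) (u v : Fin n) (k : ℕ) where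

  addEdge-new : ∀ {x y} → SamePair x y u v → addEdge c u v k x y ≡ just k
  addEdge-new {x} {y} (inj₁ (refl , refl)) with x Fin.≟ x | y Fin.≟ y
  ... | yes _ | yes _ = refl
  ... | no x≢x | _    = contradiction refl x≢x
  ... | yes _ | no y≢y = contradiction refl y≢y
  addEdge-new {x} {y} (inj₂ (refl , refl)) with x Fin.≟ x | y Fin.≟ y
  ... | no x≢x | _    = contradiction refl x≢x
  ... | yes _ | no y≢y = contradiction refl y≢y
  ... | yes _ | yes _ with x Fin.≟ u | y Fin.≟ v
  ...   | yes _ | yes _ = refl
  ...   | yes _ | no _  = refl
  ...   | no _  | _     = refl

  addEdge-old : ∀ {x y} → ¬ SamePair x y u v → addEdge c u v k x y ≡ c x y
  addEdge-old {x} {y} other with x Fin.≟ u | y Fin.≟ v | x Fin.≟ v | y Fin.≟ u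
  ... | yes x≡u | yes y≡v | _       | _       = contradiction (inj₁ (x≡u , y≡v)) other
  ... | _       | _       | yes x≡v | yes y≡u = contradiction (inj₂ (x≡v , y≡u)) other
  ... | no _    | _       | no _    | _       = refl
  ... | no _    | _       | yes _   | no _    = refl
  ... | yes _   | no _    | no _    | _       = refl
  ... | yes _   | no _    | yes _   | no _    = refl

rainbow-by-colours : ∀ {r n} (c : Fin n → Fin n → Maybe ℕ) (g : Fin r → Fin n)
  (κ : Fin r → Fin r → ℕ) → (∀ a b → g a ≡ g b → a ≡ b) →
  (∀ a b → a ≢ b → c (g a) (g b) ≡ just (κ a b)) →
  (∀ a b a' b' → a ≢ b → a' ≢ b' → κ a b ≡ κ a' b' → SamePair a b a' b') →
  IsRainbowK r c g
rainbow-by-colours c g κ g-inj coloured κ-inj =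
  g-inj , (λ a b a≢b → κ a b , coloured a b a≢b) ,
  λ a b a' b' K a≢b a'≢b' e e' → κ-inj a b a' b' a≢b a'≢b'
    (just-injective (trans (sym (coloured a b a≢b)) (trans e (trans (sym e') (coloured a' b' a'≢b')))))

module Completion {n : ℕ} (c : Fin n → Fin n → Maybe ℕ) (c-sym : ∀ x y → c x y ≡ c y x)
  (κ : Fin n → Fin n → ℕ) (κ-sym : ∀ x y → κ x y ≡ κ y x)
  (κ-inj : ∀ x y x' y' → κ x y ≡ κ x' y' → SamePair x y x' y') where

  clique : ∀ {m} → Fin n → Fin n → (Fin m → Fin n) → Fin (suc (suc m)) → Fin n
  clique u v s zero             = u
  clique u v s (suc zero)   = v
  clique u v s (suc (suc p)) = s p

  module _ {m : ℕ} (u v : Fin n) (u≢v : u ≢ v) (k : ℕ) (s : Fin m → Fin n)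
    (s-inj : ∀ p q → s p ≡ s q → p ≡ q) (s≢u : ∀ p → s p ≢ u) (s≢v : ∀ p → s p ≢ v)
    (old-edge : ∀ p b → suc (suc p) ≢ b →
                c (s p) (clique u v s b) ≡ just (κ (s p) (clique u v s b)) ×
                κ (s p) (clique u v s b) ≢ k) where

    g : Fin (suc (suc m)) → Fin n
    g = clique u v s

    g-inj : ∀ a b → g a ≡ g b → a ≡ b
    g-inj zero              zero              _ = refl
    g-inj zero              (suc zero)    e = contradiction e u≢v
    g-inj zero              (suc (suc q)) e = contradiction (sym e) (s≢u q)
    g-inj (suc zero)    zero              e = contradiction (sym e) u≢v
    g-inj (suc zero)    (suc zero)    _ = refl
    g-inj (suc zero)    (suc (suc q)) e = contradiction (sym e) (s≢v q)
    g-inj (suc (suc p)) zero              e = contradiction e (s≢u p)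
    g-inj (suc (suc p)) (suc zero)    e = contradiction e (s≢v p)
    g-inj (suc (suc p)) (suc (suc q)) e = cong (Fin.suc ∘ Fin.suc) (s-inj p q e)

    colour : Fin (suc (suc m)) → Fin (suc (suc m)) → ℕ
    colour zero           (suc zero) = k
    colour (suc zero) zero           = k
    colour a                  b                  = κ (g a) (g b)

    NewPair : Fin (suc (suc m)) → Fin (suc (suc m)) → Set
    NewPair a b = SamePair a b zero (suc zero)

    OldPair : Fin (suc (suc m)) → Fin (suc (suc m)) → Set
    OldPair a b = ¬ SamePair (g a) (g b) u v ×
                  c (g a) (g b) ≡ just (colour a b) × colour a b ≡ κ (g a) (g b) × colour a b ≢ k

    old-from : ∀ p b → suc (suc p) ≢ b → OldPair (suc (suc p)) b
    old-from p b ne = away , proj₁ (old-edge p b ne) , refl , proj₂ (old-edge p b ne)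
      where
        away : ¬ SamePair (s p) (g b) u v
        away (inj₁ (e , _)) = s≢u p e
        away (inj₂ (e , _)) = s≢v p e

    colour-to : ∀ p b → colour b (suc (suc p)) ≡ κ (g b) (s p)
    colour-to p zero              = refl
    colour-to p (suc zero)    = refl
    colour-to p (suc (suc q)) = refl

    old-to : ∀ p b → suc (suc p) ≢ b → OldPair b (suc (suc p))
    old-to p b ne rewrite colour-to p b = away , edge , refl , code≢k
      where
        away : ¬ SamePair (g b) (s p) u v
        away (inj₁ (_ , e)) = s≢v p e
        away (inj₂ (_ , e)) = s≢u p e
        edge : c (g b) (s p) ≡ just (κ (g b) (s p))
        edge = begin
          c (g b) (s p)          ≡⟨ c-sym (g b) (s p) ⟩
          c (s p) (g b)          ≡⟨ proj₁ (old-edge p b ne) ⟩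
          just (κ (s p) (g b))   ≡⟨ cong just (κ-sym (s p) (g b)) ⟩
          just (κ (g b) (s p))   ∎
          where open ≡-Reasoning
        code≢k : κ (g b) (s p) ≢ k
        code≢k e = proj₂ (old-edge p b ne) (trans (κ-sym (s p) (g b)) e)

    pair-kind : ∀ a b → a ≢ b → (NewPair a b × colour a b ≡ k) ⊎ OldPair a b
    pair-kind zero              zero              ne = contradiction refl ne
    pair-kind zero              (suc zero)    ne = inj₁ (inj₁ (refl , refl) , refl)
    pair-kind zero              (suc (suc q)) ne = inj₂ (old-to q zero (ne ∘ sym))
    pair-kind (suc zero)    zero              ne = inj₁ (inj₂ (refl , refl) , refl)
    pair-kind (suc zero)    (suc zero)    ne = contradiction refl ne
    pair-kind (suc zero)    (suc (suc q)) ne = inj₂ (old-to q (suc zero) (ne ∘ sym))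
    pair-kind (suc (suc p)) b                     ne = inj₂ (old-from p b ne)

    coloured : ∀ a b → a ≢ b → addEdge c u v k (g a) (g b) ≡ just (colour a b)
    coloured a b ne with pair-kind a b ne
    ... | inj₁ (new , colour≡k) =
          trans (addEdge-new c u v k (SamePair-map g new)) (cong just (sym colour≡k))
    ... | inj₂ (away , edge , _) = trans (addEdge-old c u v k away) edge

    colour-inj : ∀ a b a' b' → a ≢ b → a' ≢ b' → colour a b ≡ colour a' b' → SamePair a b a' b'
    colour-inj a b a' b' ne ne' e with pair-kind a b ne | pair-kind a' b' ne'
    ... | inj₁ (new , _) | inj₁ (new' , _) = SamePair-trans new (SamePair-sym new')
    ... | inj₁ (_ , colour≡k) | inj₂ (_ , _ , _ , colour'≢k) =
          ⊥-elim (colour'≢k (trans (sym e) colour≡k))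
    ... | inj₂ (_ , _ , _ , colour≢k) | inj₁ (_ , colour'≡k) = ⊥-elim (colour≢k (trans e colour'≡k))
    ... | inj₂ (_ , _ , coded , _) | inj₂ (_ , _ , coded' , _) =
          SamePair-reflect g g-inj (κ-inj _ _ _ _ (trans (sym coded) (trans e coded')))

    completion : HasRainbowK (suc (suc m)) (addEdge c u v k)
    completion = g , rainbow-by-colours (addEdge c u v k) g colour g-inj coloured colour-inj

minmax-pair : ∀ {n} (x y x' y' : Fin n) →
              toℕ x ⊓ toℕ y ≡ toℕ x' ⊓ toℕ y' → toℕ x ⊔ toℕ y ≡ toℕ x' ⊔ toℕ y' → SamePair x y x' y'
minmax-pair x y x' y' min≡ max≡
  with ≤-total (toℕ x) (toℕ y) | ≤-total (toℕ x') (toℕ y')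
... | inj₁ p | inj₁ q
  rewrite m≤n⇒m⊓n≡m p | m≤n⇒m⊓n≡m q | m≤n⇒m⊔n≡n p | m≤n⇒m⊔n≡n q =
    inj₁ (toℕ-injective min≡ , toℕ-injective max≡)
... | inj₁ p | inj₂ q
  rewrite m≤n⇒m⊓n≡m p | m≥n⇒m⊓n≡n q | m≤n⇒m⊔n≡n p | m≥n⇒m⊔n≡m q =
    inj₂ (toℕ-injective min≡ , toℕ-injective max≡)
... | inj₂ p | inj₁ q
  rewrite m≥n⇒m⊓n≡n p | m≤n⇒m⊓n≡m q | m≥n⇒m⊔n≡m p | m≤n⇒m⊔n≡n q =
    inj₂ (toℕ-injective max≡ , toℕ-injective min≡)
... | inj₂ p | inj₂ q
  rewrite m≥n⇒m⊓n≡n p | m≥n⇒m⊓n≡n q | m≥n⇒m⊔n≡m p | m≥n⇒m⊔n≡m q =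
    inj₁ (toℕ-injective max≡ , toℕ-injective min≡)

module PairCode (n : ℕ) where

  code : ℕ → ℕ → ℕ
  code a b = a ⊓ b + (a ⊔ b) * n

  code-sym : ∀ a b → code a b ≡ code b a
  code-sym a b rewrite ⊓-comm a b | ⊔-comm a b = refl

  minOf : .{{NonZero n}} → ℕ → ℕ
  minOf k = k ℕ.% n

  minOf-code : .{{_ : NonZero n}} → ∀ a b → a ⊓ b < n → minOf (code a b) ≡ a ⊓ b
  minOf-code a b min<n = trans (DM.[m+kn]%n≡m%n (a ⊓ b) (a ⊔ b) n) (DM.m<n⇒m%n≡m min<n)

  code-inj : ∀ a b a' b' → a ⊓ b < n → a' ⊓ b' < n → code a b ≡ code a' b' →
             a ⊓ b ≡ a' ⊓ b' × a ⊔ b ≡ a' ⊔ b'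
  code-inj a b a' b' min<n min'<n e = min≡ , max≡
    where
      instance
        n≢0 : NonZero n
        n≢0 = ℕ.>-nonZero (≤-<-trans z≤n min<n)
      min≡ : a ⊓ b ≡ a' ⊓ b'
      min≡ = trans (sym (minOf-code a b min<n)) (trans (cong minOf e) (minOf-code a' b' min'<n))
      max≡ : a ⊔ b ≡ a' ⊔ b'
      max≡ = *-cancelʳ-≡ (a ⊔ b) (a' ⊔ b') n
        (+-cancelˡ-≡ (a ⊓ b) _ _ (trans e (cong (_+ (a' ⊔ b') * n) (sym min≡))))

  vcode : Fin n → Fin n → ℕ
  vcode x y = code (toℕ x) (toℕ y)

  vcode-sym : ∀ x y → vcode x y ≡ vcode y x
  vcode-sym x y = code-sym (toℕ x) (toℕ y)

  vcode-inj : ∀ x y x' y' → vcode x y ≡ vcode x' y' → SamePair x y x' y'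
  vcode-inj x y x' y' e = minmax-pair x y x' y' min≡ max≡
    where
      below : ∀ (x y : Fin n) → toℕ x ⊓ toℕ y < n
      below x y = ≤-<-trans (m⊓n≤m (toℕ x) (toℕ y)) (Finₚ.toℕ<n x)
      min≡ : toℕ x ⊓ toℕ y ≡ toℕ x' ⊓ toℕ y'
      min≡ = proj₁ (code-inj _ _ _ _ (below x y) (below x' y') e)
      max≡ : toℕ x ⊔ toℕ y ≡ toℕ x' ⊔ toℕ y'
      max≡ = proj₂ (code-inj _ _ _ _ (below x y) (below x' y') e)

-- Among at least four elements, two distinct ones avoid any given pair a ≠ b: punch out a,
-- then b, and punch two distinct elements back in.
two-others : ∀ {N} (a b : Fin (suc (suc (suc (suc N))))) → a ≢ b →
             Σ (Fin (suc (suc (suc (suc N))))) λ w → Σ (Fin (suc (suc (suc (suc N))))) λ w' →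
             w ≢ w' × (w ≢ a × w ≢ b) × (w' ≢ a × w' ≢ b)
two-others {N} a b a≢b =
  avoid zero , avoid (suc zero) , (λ e → 0≢1 (avoid-inj e)) ,
  (avoid≢a zero , avoid≢b zero) , (avoid≢a (suc zero) , avoid≢b (suc zero))
  where
    b' : Fin (suc (suc (suc N)))
    b' = punchOut a≢b
    avoid : Fin (suc (suc N)) → Fin (suc (suc (suc (suc N))))
    avoid y = punchIn a (punchIn b' y)
    avoid≢a : ∀ y → avoid y ≢ a
    avoid≢a y = Finₚ.punchInᵢ≢i a _
    avoid≢b : ∀ y → avoid y ≢ b
    avoid≢b y e = Finₚ.punchInᵢ≢i b' y
      (Finₚ.punchIn-injective a _ _ (trans e (sym (Finₚ.punchIn-punchOut a≢b))))
    avoid-inj : ∀ {y y'} → avoid y ≡ avoid y' → y ≡ y'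
    avoid-inj e = Finₚ.punchIn-injective b' _ _ (Finₚ.punchIn-injective a _ _ e)
    0≢1 : zero ≢ suc {suc N} zero
    0≢1 ()

monoCol : ∀ {n} → Fin n → Fin n → Maybe ℕ
monoCol i j with i Fin.≟ j
... | yes _ = nothing
... | no _  = just 0

monoCol-edge : ∀ {n} {i j : Fin n} → i ≢ j → monoCol i j ≡ just 0
monoCol-edge {i = i} {j} i≢j with i Fin.≟ j
... | yes i≡j = contradiction i≡j i≢j
... | no _    = refl

monoComplete : ∀ n → ECGraph n
monoComplete n = record { col = monoCol ; symm = symm′ ; irrefl = irrefl′ }
  where
    symm′ : ∀ i j → monoCol i j ≡ monoCol j i
    symm′ i j with i Fin.≟ j | j Fin.≟ i
    ... | yes _   | yes _   = refl
    ... | no _    | no _    = refl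
    ... | yes i≡j | no j≢i  = contradiction (sym i≡j) j≢i
    ... | no i≢j  | yes j≡i = contradiction (sym j≡i) i≢j
    irrefl′ : ∀ i → monoCol i i ≡ nothing
    irrefl′ i with i Fin.≟ i
    ... | yes _   = refl
    ... | no i≢i  = contradiction refl i≢i

-- For r ≥ 3 the monochromatic complete graph is saturated: it has no rainbow triangle, let
-- alone a rainbow K_r, and it has no non-edges at all.
monoComplete-saturated : ∀ n r → 3 ≤ r → RainbowSaturated r (monoComplete n)
monoComplete-saturated n (suc (suc (suc r))) _ =
  no-rainbow , λ u v u≢v non-edge → ⊥-elim (no-non-edge u≢v non-edge)
  where
    -- The clique edges 01 and 02 have the same colour 0.
    no-rainbow : ¬ HasRainbowK (suc (suc (suc r))) monoCol
    no-rainbow (f , f-inj , _ , distinct)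
      with distinct zero (suc zero) zero (suc (suc zero)) 0 (λ ()) (λ ())
                    (monoCol-edge (λ e → 0≢1 (f-inj _ _ e))) (monoCol-edge (λ e → 0≢2 (f-inj _ _ e)))
      where
        0≢1 : zero ≢ suc {suc (suc r)} zero
        0≢1 ()
        0≢2 : zero ≢ suc {suc (suc r)} (suc zero)
        0≢2 ()
    ... | inj₁ (_ , ())
    ... | inj₂ (() , _)
    no-non-edge : ∀ {u v : Fin n} → u ≢ v → monoCol u v ≢ nothing
    no-non-edge u≢v non-edge with () ← trans (sym (monoCol-edge u≢v)) non-edge
monoComplete-saturated n (suc (suc zero)) (s≤s (s≤s ()))
monoComplete-saturated n (suc zero)       (s≤s ())

-- On at most three vertices no edge has both endpoints ≥ 2, so there are at most 2n edges.
monoComplete-≤ : ∀ {n} → n ≤ 3 → edgeCount (monoComplete n) ≤ 2 * n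
monoComplete-≤ {n} n≤3 = edgeCount-≤ (monoComplete n) 2 λ i j 2≤i i<j →
  ⊥-elim (≤⇒≯ n≤3 (<-≤-trans (s≤s (≤-trans (s≤s 2≤i) i<j)) (Finₚ.toℕ<n j)))

rainbow-adjacent : ∀ {r n} {c : Fin n → Fin n → Maybe ℕ} {f : Fin r → Fin n} →
                   IsRainbowK r c f → ∀ a b → a ≢ b → c (f a) (f b) ≢ nothing
rainbow-adjacent (_ , edges , _) a b a≢b non-edge
  with () ← trans (sym (proj₂ (edges a b a≢b))) non-edge

data Class : Set where
  A B R : Class

CrossPair : Class → Class → Set
CrossPair C D = (C ≡ A × D ≡ B) ⊎ (C ≡ B × D ≡ A)

module Construction (n m : ℕ) (cross : Maybe ℕ) where
  open PairCode n

  InClass : Class → ℕ → Set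
  InClass A x = x < m
  InClass B x = m ≤ x × x < m + m
  InClass R x = m + m ≤ x

  cls : ℕ → Class
  cls x with x ℕ.<? m | x ℕ.<? m + m
  ... | yes _ | _     = A
  ... | no _  | yes _ = B
  ... | no _  | no _  = R

  classify : ∀ x → InClass (cls x) x
  classify x with x ℕ.<? m | x ℕ.<? m + m
  ... | yes x<m | _        = x<m
  ... | no x≮m  | yes x<2m = ≮⇒≥ x≮m , x<2m
  ... | no _    | no x≮2m  = ≮⇒≥ x≮2m

  class-unique : ∀ C D {x} → InClass C x → InClass D x → C ≡ D
  class-unique A A _ _ = refl
  class-unique B B _ _ = refl
  class-unique R R _ _ = refl
  class-unique A B x<m (m≤x , _) = contradiction x<m (≤⇒≯ m≤x)
  class-unique B A (m≤x , _) x<m = contradiction x<m (≤⇒≯ m≤x)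
  class-unique A R x<m 2m≤x = contradiction (<-≤-trans x<m (m≤m+n m m)) (≤⇒≯ 2m≤x)
  class-unique R A 2m≤x x<m = contradiction (<-≤-trans x<m (m≤m+n m m)) (≤⇒≯ 2m≤x)
  class-unique B R (_ , x<2m) 2m≤x = contradiction x<2m (≤⇒≯ 2m≤x)
  class-unique R B 2m≤x (_ , x<2m) = contradiction x<2m (≤⇒≯ 2m≤x)

  cls-of : ∀ {C x} → InClass C x → cls x ≡ C
  cls-of {C} {x} h = class-unique (cls x) C (classify x) h

  in-class : ∀ {C x} → cls x ≡ C → InClass C x
  in-class {x = x} refl = classify x

  link : Class → Class → ℕ → Maybe ℕ
  link R R _ = nothing
  link A B _ = cross
  link B A _ = cross
  link _ _ c = just c

  link-sym : ∀ C D c → link C D c ≡ link D C c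
  link-sym A A c = refl
  link-sym A B c = refl
  link-sym A R c = refl
  link-sym B A c = refl
  link-sym B B c = refl
  link-sym B R c = refl
  link-sym R A c = refl
  link-sym R B c = refl
  link-sym R R c = refl

  link-coded : ∀ S D c → S ≢ R → D ≡ S ⊎ D ≡ R → link S D c ≡ just c
  link-coded A _ c _ (inj₁ refl) = refl
  link-coded A _ c _ (inj₂ refl) = refl
  link-coded B _ c _ (inj₁ refl) = refl
  link-coded B _ c _ (inj₂ refl) = refl
  link-coded R _ c S≢R _ = contradiction refl S≢R

  colourN : ℕ → ℕ → Maybe ℕ
  colourN x y with x ℕ.≟ y
  ... | yes _ = nothing
  ... | no _  = link (cls x) (cls y) (code x y)

  colourN-edge : ∀ {x y} → x ≢ y → colourN x y ≡ link (cls x) (cls y) (code x y)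
  colourN-edge {x} {y} x≢y with x ℕ.≟ y
  ... | yes x≡y = contradiction x≡y x≢y
  ... | no _    = refl

  graph : ECGraph n
  graph = record { col = λ i j → colourN (toℕ i) (toℕ j) ; symm = symm′ ; irrefl = irrefl′ }
    where
      symm′ : ∀ i j → colourN (toℕ i) (toℕ j) ≡ colourN (toℕ j) (toℕ i)
      symm′ i j with toℕ i ℕ.≟ toℕ j | toℕ j ℕ.≟ toℕ i
      ... | yes _   | yes _   = refl
      ... | yes i≡j | no j≢i  = contradiction (sym i≡j) j≢i
      ... | no i≢j  | yes j≡i = contradiction (sym j≡i) i≢j
      ... | no _    | no _    = trans (link-sym (cls (toℕ i)) (cls (toℕ j)) _)
                                      (cong (link _ _) (code-sym (toℕ i) (toℕ j)))
      irrefl′ : ∀ i → colourN (toℕ i) (toℕ i) ≡ nothing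
      irrefl′ i with toℕ i ℕ.≟ toℕ i
      ... | yes _   = refl
      ... | no i≢i  = contradiction refl i≢i

  R-independent : ∀ {x y} → cls x ≡ R → cls y ≡ R → colourN x y ≡ nothing
  R-independent {x} {y} xR yR with x ℕ.≟ y
  ... | yes _ = refl
  ... | no _ rewrite xR | yR = refl

  non-edge-kind : ∀ {x y} → x ≢ y → colourN x y ≡ nothing →
                  (cls x ≡ R × cls y ≡ R) ⊎ (cross ≡ nothing × CrossPair (cls x) (cls y))
  non-edge-kind {x} {y} x≢y non-edge =
    kind (cls x) (cls y) (trans (sym (colourN-edge x≢y)) non-edge)
    where
      kind : ∀ C D → link C D (code x y) ≡ nothing →
             (C ≡ R × D ≡ R) ⊎ (cross ≡ nothing × CrossPair C D)
      kind A B e = inj₂ (e , inj₁ (refl , refl))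
      kind B A e = inj₂ (e , inj₂ (refl , refl))
      kind R R _ = inj₁ (refl , refl)
      kind A A ()
      kind A R ()
      kind B B ()
      kind B R ()
      kind R A ()
      kind R B ()

  -- Every edge has an endpoint in A ∪ B, hence there are at most 2mn edges.
  edges-≤ : edgeCount graph ≤ 2 * m * n
  edges-≤ = subst (λ z → edgeCount graph ≤ (m + z) * n) (sym (+-identityʳ m))
    (edgeCount-≤ graph (m + m) λ i j 2m≤i i<j →
      R-independent (cls-of {R} 2m≤i) (cls-of {R} (≤-trans 2m≤i (<⇒≤ i<j))))

  open Completion (col graph) (symm graph) vcode vcode-sym vcode-inj

  -- Adding a missing edge uv inside R creates a rainbow K_{m+2}: the colour k can be the code
  -- of a pair with minimum t = minOf k only, so one of the blocks A, B avoids t, and that block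
  -- together with u and v is a K_{m+2} minus uv whose colours are distinct codes other than k.
  module _ (u v : Fin n) (u≢v : u ≢ v) (uR : cls (toℕ u) ≡ R) (vR : cls (toℕ v) ≡ R) (k : ℕ) where

    instance
      n≢0 : NonZero n
      n≢0 = ℕ.>-nonZero (≤-<-trans z≤n (Finₚ.toℕ<n u))

    t : ℕ
    t = minOf k

    coded-edge : ∀ S (x y : Fin n) → S ≢ R → x ≢ y → cls (toℕ x) ≡ S →
                 cls (toℕ y) ≡ S ⊎ cls (toℕ y) ≡ R → toℕ x ⊓ toℕ y ≢ t →
                 colourN (toℕ x) (toℕ y) ≡ just (vcode x y) × vcode x y ≢ k
    coded-edge S x y S≢R x≢y xS yS⊎R min≢t = edge , code≢k
      where
        edge : colourN (toℕ x) (toℕ y) ≡ just (vcode x y)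
        edge rewrite colourN-edge (x≢y ∘ toℕ-injective) | xS = link-coded S _ _ S≢R yS⊎R
        code≢k : vcode x y ≢ k
        code≢k e = min≢t (trans (sym (minOf-code (toℕ x) (toℕ y)
                     (≤-<-trans (m⊓n≤m (toℕ x) (toℕ y)) (Finₚ.toℕ<n x)))) (cong minOf e))

    module Block (off : ℕ) (S : Class) (off≤m : off ≤ m) (S≢R : S ≢ R)
                 (in-S : ∀ p → p < m → cls (off + p) ≡ S)
                 (avoids-t : ∀ p → p < m → off + p ≢ t) where

      below : ∀ (p : Fin m) (w : Fin n) → cls (toℕ w) ≡ R → off + toℕ p < toℕ w
      below p w wR = <-≤-trans (+-mono-≤-< off≤m (Finₚ.toℕ<n p)) (in-class wR)

      s : Fin m → Fin n
      s p = fromℕ< (<-trans (below p u uR) (Finₚ.toℕ<n u))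

      toℕ-s : ∀ p → toℕ (s p) ≡ off + toℕ p
      toℕ-s p = Finₚ.toℕ-fromℕ< _

      s-inj : ∀ p q → s p ≡ s q → p ≡ q
      s-inj p q e = toℕ-injective (+-cancelˡ-≡ off _ _
        (trans (sym (toℕ-s p)) (trans (cong toℕ e) (toℕ-s q))))

      s-below : ∀ p w → cls (toℕ w) ≡ R → toℕ (s p) < toℕ w
      s-below p w wR rewrite toℕ-s p = below p w wR

      s≢R : ∀ p w → cls (toℕ w) ≡ R → s p ≢ w
      s≢R p w wR e = <-irrefl (cong toℕ e) (s-below p w wR)

      s-in-S : ∀ p → cls (toℕ (s p)) ≡ S
      s-in-S p rewrite toℕ-s p = in-S (toℕ p) (Finₚ.toℕ<n p)

      s≢t : ∀ p → toℕ (s p) ≢ t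
      s≢t p rewrite toℕ-s p = avoids-t (toℕ p) (Finₚ.toℕ<n p)

      -- Edges from s p to u and v have minimum s p; inside the block the minimum is a block vertex.
      min-to-R : ∀ p w → cls (toℕ w) ≡ R → toℕ (s p) ⊓ toℕ w ≢ t
      min-to-R p w wR rewrite m≤n⇒m⊓n≡m (<⇒≤ (s-below p w wR)) = s≢t p

      min-in-block : ∀ p q → toℕ (s p) ⊓ toℕ (s q) ≢ t
      min-in-block p q with ⊓-sel (toℕ (s p)) (toℕ (s q))
      ... | inj₁ e = subst (_≢ t) (sym e) (s≢t p)
      ... | inj₂ e = subst (_≢ t) (sym e) (s≢t q)

      old-edge : ∀ p b → suc (suc p) ≢ b →
                 colourN (toℕ (s p)) (toℕ (clique u v s b)) ≡ just (vcode (s p) (clique u v s b)) ×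
                 vcode (s p) (clique u v s b) ≢ k
      old-edge p zero _ =
        coded-edge S (s p) u S≢R (s≢R p u uR) (s-in-S p) (inj₂ uR) (min-to-R p u uR)
      old-edge p (suc zero) _ =
        coded-edge S (s p) v S≢R (s≢R p v vR) (s-in-S p) (inj₂ vR) (min-to-R p v vR)
      old-edge p (suc (suc q)) p≢q =
        coded-edge S (s p) (s q) S≢R (p≢q ∘ cong (Fin.suc ∘ Fin.suc) ∘ s-inj p q) (s-in-S p)
                   (inj₁ (s-in-S q)) (min-in-block p q)

      block-completion : HasRainbowK (suc (suc m)) (addEdge (col graph) u v k)
      block-completion = completion u v u≢v k s s-inj (λ p → s≢R p u uR) (λ p → s≢R p v vR) old-edge

    R-saturated : HasRainbowK (suc (suc m)) (addEdge (col graph) u v k)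
    R-saturated with t ℕ.<? m
    ... | yes t<m = Block.block-completion m B ≤-refl (λ ())
                      (λ p p<m → cls-of {B} (m≤m+n m p , +-monoʳ-< m p<m))
                      (λ p _ e → <⇒≱ t<m (subst (m ≤_) e (m≤m+n m p)))
    ... | no t≮m  = Block.block-completion 0 A z≤n (λ ()) (λ p p<m → cls-of {A} p<m)
                      (λ p p<m e → t≮m (subst (_< m) e p<m))

  saturated : (∀ u v → u ≢ v → cross ≡ nothing → CrossPair (cls (toℕ u)) (cls (toℕ v)) →
                 ∀ k → HasRainbowK (suc (suc m)) (addEdge (col graph) u v k)) →
              ∀ u v → u ≢ v → col graph u v ≡ nothing →
                 ∀ k → HasRainbowK (suc (suc m)) (addEdge (col graph) u v k)
  saturated cross-case u v u≢v non-edge k with non-edge-kind (u≢v ∘ toℕ-injective) non-edge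
  ... | inj₁ (uR , vR)         = R-saturated u v u≢v uR vR k
  ... | inj₂ (none , crossing) = cross-case u v u≢v none crossing k

-- r = 3: with m = 1 and no cross edge, the graph is bipartite between {0, 1} and R, so it is
-- triangle-free; adding the edge 01 closes a rainbow triangle with a suitable vertex of R.
module Triangle (n : ℕ) where
  open PairCode n
  open Construction n 1 nothing

  side : Class → Fin 2
  side R = suc zero
  side _ = zero

  same-side-non-edge : ∀ {x y} → x ≢ y → side (cls x) ≡ side (cls y) → colourN x y ≡ nothing
  same-side-non-edge {x} {y} x≢y same with cls x in xC | cls y in yC
  ... | R | R = R-independent xC yC
  ... | A | B = trans (colourN-edge x≢y) (cong₂ (λ C D → link C D (code x y)) xC yC)
  ... | B | A = trans (colourN-edge x≢y) (cong₂ (λ C D → link C D (code x y)) xC yC)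
  ... | A | A = contradiction (trans (n<1⇒n≡0 (in-class xC)) (sym (n<1⇒n≡0 (in-class yC)))) x≢y
  ... | B | B = contradiction (trans (one (in-class xC)) (sym (one (in-class yC)))) x≢y
    where one : ∀ {z} → 1 ≤ z × z < 2 → z ≡ 1
          one (1≤z , z<2) = ≤-antisym (ℕ.s≤s⁻¹ z<2) 1≤z
  ... | A | R with () ← same
  ... | B | R with () ← same
  ... | R | A with () ← same
  ... | R | B with () ← same

  -- Two of the three vertices of a triangle lie on the same side, hence are not adjacent.
  triangle-free : ¬ HasRainbowK 3 (col graph)
  triangle-free (f , rainbow) with Finₚ.pigeonhole (n<1+n 2) (λ a → side (cls (toℕ (f a))))
  ... | i , j , i<j , same = rainbow-adjacent {c = col graph} rainbow i j i≢j
          (same-side-non-edge (i≢j ∘ proj₁ rainbow i j ∘ toℕ-injective) same)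
    where
      i≢j : i ≢ j
      i≢j = Finₚ.<⇒≢ i<j

  cross-end : ∀ {x} → cls x ≡ A ⊎ cls x ≡ B → x < 2 × cls x ≢ R
  cross-end {x} (inj₁ xA) = <-trans (in-class xA) (n<1+n 1) , λ xR → A≢R (trans (sym xA) xR)
    where
      A≢R : A ≢ R
      A≢R ()
  cross-end {x} (inj₂ xB) = proj₂ (in-class xB) , λ xR → B≢R (trans (sym xB) xR)
    where
      B≢R : B ≢ R
      B≢R ()

  open Completion (col graph) (symm graph) vcode vcode-sym vcode-inj

  -- Adding the missing edge uv between 0 and 1 creates a rainbow triangle uvW with a hub
  -- W ∈ {2, 3}: the codes of W u and W v are distinct from uv's colour k for W = 2 or for W = 3.
  module _ (3<n : 3 < n) (u v : Fin n) (u≢v : u ≢ v) (u-end : toℕ u < 2 × cls (toℕ u) ≢ R)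
           (v-end : toℕ v < 2 × cls (toℕ v) ≢ R) (k : ℕ) where

    hub-edge : ∀ (W : Fin n) y → 2 ≤ toℕ W → y < 2 × cls y ≢ R →
               colourN (toℕ W) y ≡ just (code (toℕ W) y)
    hub-edge W y 2≤W (y<2 , yR) rewrite colourN-edge (λ e → <⇒≱ y<2 (subst (2 ≤_) e 2≤W))
                                     | cls-of {R} {toℕ W} 2≤W =
      trans (link-sym R (cls y) _) (link-coded (cls y) R _ yR (inj₂ refl))

    hub-completion : (W : Fin n) → 2 ≤ toℕ W → vcode W u ≢ k → vcode W v ≢ k →
                     HasRainbowK 3 (addEdge (col graph) u v k)
    hub-completion W 2≤W Wu≢k Wv≢k =
      completion u v u≢v k hub (λ { zero zero _ → refl }) (W≢ u u-end) (W≢ v v-end) old-edge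
      where
        hub : Fin 1 → Fin n
        hub _ = W
        W≢ : ∀ y → toℕ y < 2 × cls (toℕ y) ≢ R → Fin 1 → W ≢ y
        W≢ y (y<2 , _) _ e = <⇒≱ y<2 (subst (λ z → 2 ≤ toℕ z) e 2≤W)
        old-edge : ∀ p b → suc (suc p) ≢ b →
                   colourN (toℕ W) (toℕ (clique u v hub b)) ≡ just (vcode W (clique u v hub b)) ×
                   vcode W (clique u v hub b) ≢ k
        old-edge zero zero             _  = hub-edge W (toℕ u) 2≤W u-end , Wu≢k
        old-edge zero (suc zero)       _  = hub-edge W (toℕ v) 2≤W v-end , Wv≢k
        old-edge zero (suc (suc zero)) ne = contradiction refl ne

    w₂ w₃ : Fin n
    w₂ = fromℕ< (<-trans (n<1+n 2) 3<n)
    w₃ = fromℕ< 3<n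

    hub-codes-differ : ∀ x y → toℕ y < 2 → vcode w₃ x ≢ vcode w₂ y
    hub-codes-differ x y y<2 e with vcode-inj w₃ x w₂ y e
    ... | inj₁ (w₃≡w₂ , _)
      with () ← trans (sym (Finₚ.toℕ-fromℕ< 3<n)) (trans (cong toℕ w₃≡w₂) (Finₚ.toℕ-fromℕ< _))
    ... | inj₂ (w₃≡y , _) =
      <⇒≱ y<2 (subst (2 ≤_) (trans (sym (Finₚ.toℕ-fromℕ< 3<n)) (cong toℕ w₃≡y)) (n≤1+n 2))

    2≤w₂ : 2 ≤ toℕ w₂
    2≤w₂ = ≤-reflexive (sym (Finₚ.toℕ-fromℕ< _))

    2≤w₃ : 2 ≤ toℕ w₃
    2≤w₃ = subst (2 ≤_) (sym (Finₚ.toℕ-fromℕ< 3<n)) (n≤1+n 2)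

    cross-saturated : HasRainbowK 3 (addEdge (col graph) u v k)
    cross-saturated with k ℕ.≟ vcode w₂ u | k ℕ.≟ vcode w₂ v
    ... | no k≢w₂u | no k≢w₂v = hub-completion w₂ 2≤w₂ (k≢w₂u ∘ sym) (k≢w₂v ∘ sym)
    ... | yes k≡w₂u | _ = hub-completion w₃ 2≤w₃
          (λ e → hub-codes-differ u u (proj₁ u-end) (trans e k≡w₂u))
          (λ e → hub-codes-differ v u (proj₁ u-end) (trans e k≡w₂u))
    ... | no _ | yes k≡w₂v = hub-completion w₃ 2≤w₃
          (λ e → hub-codes-differ u v (proj₁ v-end) (trans e k≡w₂v))
          (λ e → hub-codes-differ v v (proj₁ v-end) (trans e k≡w₂v))

  triangle-saturated : 3 < n → RainbowSaturated 3 graph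
  triangle-saturated 3<n = triangle-free , saturated cross-case
    where
      cross-case : ∀ u v → u ≢ v → nothing ≡ nothing → CrossPair (cls (toℕ u)) (cls (toℕ v)) →
                   ∀ k → HasRainbowK 3 (addEdge (col graph) u v k)
      cross-case u v u≢v _ (inj₁ (uA , vB)) =
        cross-saturated 3<n u v u≢v (cross-end (inj₁ uA)) (cross-end (inj₂ vB))
      cross-case u v u≢v _ (inj₂ (uB , vA)) =
        cross-saturated 3<n u v u≢v (cross-end (inj₂ uB)) (cross-end (inj₁ vA))

-- r = M + 2 ≥ 4: with cross colour 0 a rainbow clique contains at most one A–B edge. Sending
-- each vertex to its position in its class (all of R to position M) and applying pigeonhole
-- to the M + 2 clique vertices yields such an edge; any further clique vertex must then lie
-- in R, but two of them cannot, since R is independent.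
module Large (n m' : ℕ) where
  M : ℕ
  M = suc (suc m')
  open PairCode n using (code)
  open Construction n M (just 0)

  slot : Class → ℕ → ℕ
  slot A x = x
  slot B x = x ∸ M
  slot R _ = M

  slot-< : ∀ C x → InClass C x → slot C x < suc M
  slot-< A x x<M         = <-trans x<M (n<1+n M)
  slot-< B x (_ , x<M+M) = <-trans (m<n+o⇒m∸n<o x M x<M+M) (n<1+n M)
  slot-< R x _           = n<1+n M

  -- Positions fit into Fin (M + 1), one fewer than the M + 2 vertices of a clique.
  position : Fin n → Fin (suc M)
  position w = fromℕ< (slot-< (cls (toℕ w)) (toℕ w) (classify (toℕ w)))

  collision : ∀ C D {x y} → InClass C x → InClass D y → x ≢ y → slot C x ≡ slot D y →
              (C ≡ R × D ≡ R) ⊎ CrossPair C D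
  collision A A _ _ x≢y e = contradiction e x≢y
  collision A B _ _ _ _ = inj₂ (inj₁ (refl , refl))
  collision B A _ _ _ _ = inj₂ (inj₂ (refl , refl))
  collision R R _ _ _ _ = inj₁ (refl , refl)
  collision B B (M≤x , _) (M≤y , _) x≢y e = contradiction (∸-cancelʳ-≡ M≤x M≤y e) x≢y
  collision A R x<M _ _ e = contradiction e (<⇒≢ x<M)
  collision R A _ y<M _ e = contradiction (sym e) (<⇒≢ y<M)
  collision B R (_ , x<M+M) _ _ e = contradiction e (<⇒≢ (m<n+o⇒m∸n<o _ M x<M+M))
  collision R B _ (_ , y<M+M) _ e = contradiction (sym e) (<⇒≢ (m<n+o⇒m∸n<o _ M y<M+M))

  cross-edge : ∀ {x y} → cls x ≡ A → cls y ≡ B → colourN x y ≡ just 0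
  cross-edge {x} {y} xA yB = trans (colourN-edge x≢y) (cong₂ (λ C D → link C D (code x y)) xA yB)
    where
      x≢y : x ≢ y
      x≢y refl with () ← trans (sym xA) yB

  module _ {f : Fin (suc (suc M)) → Fin n} (rainbow : IsRainbowK (suc (suc M)) (col graph) f) where

    cross-distinct : ∀ {a b} → cls (toℕ (f a)) ≡ A → cls (toℕ (f b)) ≡ B → a ≢ b
    cross-distinct aA bB refl with () ← trans (sym aA) bB

    -- Beside a cross pair ab, every vertex of a rainbow clique lies in R: a further vertex in
    -- A or B would span a second cross edge of colour 0.
    others-in-R : ∀ {a b} → cls (toℕ (f a)) ≡ A → cls (toℕ (f b)) ≡ B →
                  ∀ w → w ≢ a → w ≢ b → cls (toℕ (f w)) ≡ R
    others-in-R {a} {b} aA bB w w≢a w≢b with cls (toℕ (f w)) in wC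
    ... | R = refl
    ... | A with proj₂ (proj₂ rainbow) w b a b 0 w≢b (cross-distinct aA bB)
                   (cross-edge wC bB) (cross-edge aA bB)
    ...   | inj₁ (w≡a , _) = contradiction w≡a w≢a
    ...   | inj₂ (w≡b , _) = contradiction w≡b w≢b
    others-in-R {a} {b} aA bB w w≢a w≢b | B
      with proj₂ (proj₂ rainbow) a w a b 0 (w≢a ∘ sym) (cross-distinct aA bB)
             (cross-edge aA wC) (cross-edge aA bB)
    ...   | inj₁ (_ , w≡b) = contradiction w≡b w≢b
    ...   | inj₂ (a≡b , _) = contradiction a≡b (cross-distinct aA bB)

    -- Since M + 2 ≥ 4, two further clique vertices exist; both in R, they are not adjacent.
    one-cross : ∀ a b → cls (toℕ (f a)) ≡ A → cls (toℕ (f b)) ≡ B → ⊥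
    one-cross a b aA bB with two-others a b (cross-distinct aA bB)
    ... | w , w' , w≢w' , (w≢a , w≢b) , (w'≢a , w'≢b) =
      rainbow-adjacent {c = col graph} rainbow w w' w≢w'
        (R-independent (others-in-R aA bB w w≢a w≢b) (others-in-R aA bB w' w'≢a w'≢b))

  no-rainbow : ¬ HasRainbowK (suc (suc M)) (col graph)
  no-rainbow (f , rainbow@(f-inj , _)) with Finₚ.pigeonhole (n<1+n (suc M)) (position ∘ f)
  ... | i , j , i<j , same
    with collision (cls (toℕ (f i))) (cls (toℕ (f j))) (classify _) (classify _)
                   (Finₚ.<⇒≢ i<j ∘ f-inj i j ∘ toℕ-injective)
                   (trans (sym (Finₚ.toℕ-fromℕ< _)) (trans (cong toℕ same) (Finₚ.toℕ-fromℕ< _)))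
  ... | inj₁ (iR , jR) =
        rainbow-adjacent {c = col graph} rainbow i j (Finₚ.<⇒≢ i<j) (R-independent iR jR)
  ... | inj₂ (inj₁ (iA , jB)) = one-cross rainbow i j iA jB
  ... | inj₂ (inj₂ (iB , jA)) = one-cross rainbow j i jA iB

  -- With cross colour 0 there are no cross non-edges, so only pairs inside R are missing.
  large-saturated : RainbowSaturated (suc (suc M)) graph
  large-saturated = no-rainbow , saturated λ _ _ _ ()

-- The theorem: for r = 3 use the monochromatic K_n when n ≤ 3 and the construction with m = 1
-- otherwise; for r ≥ 4 use the construction with m = r - 2 and cross colour 0.
corollary3p15 : (r : ℕ) → 3 ≤ r → (n : ℕ) →
    Σ (ECGraph n) (λ G → RainbowSaturated r G × edgeCount G ≤ 2 * (r ∸ 2) * n)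
corollary3p15 (suc (suc (suc zero))) _ n with n ℕ.≤? 3
... | yes n≤3 = monoComplete n , monoComplete-saturated n 3 ≤-refl , monoComplete-≤ n≤3
... | no n≰3  = Construction.graph n 1 nothing , Triangle.triangle-saturated n (≰⇒> n≰3) ,
                Construction.edges-≤ n 1 nothing
corollary3p15 (suc (suc (suc (suc m')))) _ n =
  Construction.graph n (suc (suc m')) (just 0) , Large.large-saturated n m' ,
  Construction.edges-≤ n (suc (suc m')) (just 0)
corollary3p15 (suc (suc zero)) (s≤s (s≤s ())) n
corollary3p15 (suc zero)       (s≤s ())       n
corollary3p15 zero             ()             n
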